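{- Let $\mathcal{G}$ be a connected graph with vertices $v_1,\dots,v_n$. Toppling dominance $\le$ with respect to $\mathcal{G}$ is a partial order on $\mathbb{Z}^n$.
   Context: $\mathcal{G}=(V,E)$ is a connected graph with vertex set $V=\{v_1,\dots,v_n\}$, no loops and at most one edge between any two vertices. $\epsilon_i\in\mathbb{Z}^n$ is the $i$th standard basis vector, $d_i$ the degree of $v_i$, $\Delta_i=\big(\sum_{j:\{v_j,v_i\}\in E}\epsilon_j\big)-d_i\epsilon_i$, and $T_i(\alpha)=\alpha+\Delta_i$. For $a\in\mathbb{Z}^n$, $T^a=T_1^{a_1}\cdots T_n^{a_n}$. Toppling dominance: for $\alpha,\beta\in\mathbb{Z}^n$, $\beta\le\alpha$ iff $\beta=T^\lambda(\alpha)$ for some $\lambda\in\mathbb{N}^n$ with $\lambda_1\ge\lambda_2\ge\cdots\ge\lambda_n$. -}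

module Defs where

open import Data.Nat as ℕ using (ℕ; zero; suc)
open import Data.Integer as ℤ using (ℤ; +_)
open import Data.Fin using (Fin; zero; suc; _≟_)
open import Data.Fin.Properties using ()
open import Data.Vec using (Vec; lookup; tabulate)
open import Data.Bool using (Bool; true; false; if_then_else_)
open import Data.List using (List; []; _∷_)
open import Data.Product using (Σ; _×_; _,_)
open import Relation.Nullary using (¬_; does)
open import Relation.Binary.PropositionalEquality using (_≡_)

-- Simple graph on vertex set Fin n (vertex v_{i+1} is Fin index i):
-- decidable adjacency, symmetric, no loops.
record Graph (n : ℕ) : Set where
  field
    adj      : Fin n → Fin n → Bool
    symmetric : ∀ i j → adj i j ≡ adj j i
    loopless  : ∀ i → adj i i ≡ false
open Graph public

data Walk {n : ℕ} (G : Graph n) : Fin n → Fin n → Set where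
  here : ∀ {i} → Walk G i i
  step : ∀ {i j k} → adj G i j ≡ true → Walk G j k → Walk G i k

Connected : ∀ {n} → Graph n → Set
Connected G = ∀ i j → Walk G i j

sumℕ : ∀ {n} → (Fin n → ℕ) → ℕ
sumℕ {zero}  f = 0
sumℕ {suc n} f = f zero ℕ.+ sumℕ (λ i → f (suc i))

sumℤ : ∀ {n} → (Fin n → ℤ) → ℤ
sumℤ {zero}  f = + 0
sumℤ {suc n} f = f zero ℤ.+ sumℤ (λ i → f (suc i))

b2ℕ : Bool → ℕ
b2ℕ true = 1
b2ℕ false = 0

degree : ∀ {n} → Graph n → Fin n → ℕ
degree G i = sumℕ (λ j → b2ℕ (adj G i j))

-- Δ_i = (Σ_{j ~ i} ε_j) − d_i ε_i ; this is its j-th coordinate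
Δ : ∀ {n} → Graph n → Fin n → Vec ℤ n
Δ G i = tabulate λ j →
  (+ b2ℕ (adj G j i)) ℤ.- (if does (i ≟ j) then + degree G i else + 0)

-- T^a(α) = α + Σ_i a_i Δ_i   (the T_i commute, being translations)
T^ : ∀ {n} → Graph n → Vec ℤ n → Vec ℤ n → Vec ℤ n
T^ G a α = tabulate λ j →
  lookup α j ℤ.+ sumℤ (λ i → lookup a i ℤ.* lookup (Δ G i) j)

NonIncreasing : ∀ {n} → Vec ℕ n → Set
NonIncreasing {n} λv = ∀ (i j : Fin n) → Data.Fin._≤_ i j → lookup λv j ℕ.≤ lookup λv i

_⊢_≼_ : ∀ {n} → Graph n → Vec ℤ n → Vec ℤ n → Set
_⊢_≼_ {n} G β α =
  Σ (Vec ℕ n) λ λv → NonIncreasing λv × (β ≡ T^ G (Data.Vec.map +_ λv) α)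

-- T^ is the action of (ℕⁿ, +) on ℤⁿ by translation by the Laplacian image L λ = Σ λᵢ Δᵢ,
-- which gives reflexivity and transitivity. For antisymmetry, α = T^λ β and β = T^μ α give
-- L (λ + μ) = 0, i.e. λ + μ is harmonic. Being nonincreasing it is maximal at v₁, so by the
-- maximum principle on the connected graph it is constant; since λ and μ are nonincreasing
-- as well, λ itself is constant, hence L λ = 0 and α = β.

module Submission where

open import Defs
open import Data.Nat using (ℕ)
open import Data.Integer using (ℤ)
open import Data.Vec using (Vec)
open import Relation.Binary.PropositionalEquality using (_≡_)
open import Relation.Binary.Structures using (IsPartialOrder)

open import Data.Bool using (Bool; true; false; if_then_else_)
open import Data.Fin using (Fin; zero; suc)
open import Data.Fin.Properties using (_≟_)
open import Data.Nat as ℕ using (zero; suc; _≤_; z≤n)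
import Data.Nat.Properties as ℕₚ
open import Data.Integer using (+_; _+_; _*_; -_; _-_)
import Data.Integer.Properties as ℤₚ
open import Data.Vec using ([]; lookup; map; replicate; zipWith)
open import Data.Vec.Properties using (lookup∘tabulate; lookup-map; lookup-replicate; lookup-zipWith)
open import Data.Vec.Relation.Binary.Pointwise.Extensional using (ext; Pointwise-≡⇒≡)
open import Data.Product using (_,_)
open import Function using (_∘_)
open import Relation.Nullary using (does)
open import Relation.Binary.PropositionalEquality
  using (refl; sym; trans; cong; cong₂; subst; subst₂; isEquivalence; module ≡-Reasoning)
open import Algebra.Properties.CommutativeSemigroup ℤₚ.+-commutativeSemigroup using (interchange)
open import Algebra.Properties.AbelianGroup ℤₚ.+-0-abelianGroup using (identityʳ-unique)

open ≡-Reasoning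

sumℤ-cong : ∀ {n} {f g : Fin n → ℤ} → (∀ i → f i ≡ g i) → sumℤ f ≡ sumℤ g
sumℤ-cong {zero}  f≗g = refl
sumℤ-cong {suc n} f≗g = cong₂ _+_ (f≗g zero) (sumℤ-cong (f≗g ∘ suc))

sumℤ-+ : ∀ {n} (f g : Fin n → ℤ) → sumℤ (λ i → f i + g i) ≡ sumℤ f + sumℤ g
sumℤ-+ {zero}  f g = refl
sumℤ-+ {suc n} f g = trans (cong (_+_ (f zero + g zero)) (sumℤ-+ (f ∘ suc) (g ∘ suc)))
                           (interchange (f zero) (g zero) _ _)

sumℤ-neg : ∀ {n} (f : Fin n → ℤ) → sumℤ (λ i → - f i) ≡ - sumℤ f
sumℤ-neg {zero}  f = refl
sumℤ-neg {suc n} f = trans (cong (_+_ (- f zero)) (sumℤ-neg (f ∘ suc)))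
                           (sym (ℤₚ.neg-distrib-+ (f zero) _))

sumℤ-pos : ∀ {n} (f : Fin n → ℕ) → sumℤ (λ i → + f i) ≡ + sumℕ f
sumℤ-pos {zero}  f = refl
sumℤ-pos {suc n} f = trans (cong (_+_ (+ f zero)) (sumℤ-pos (f ∘ suc)))
                           (sym (ℤₚ.pos-+ (f zero) _))

sumℤ-zero : ∀ {n} → sumℤ {n} (λ _ → + 0) ≡ + 0
sumℤ-zero {zero}  = refl
sumℤ-zero {suc n} = trans (ℤₚ.+-identityˡ _) (sumℤ-zero {n})

sumℤ-indicator : ∀ {n} (g : Fin n → ℤ) (j : Fin n) →
                 sumℤ (λ i → if does (i ≟ j) then g i else + 0) ≡ g j
sumℤ-indicator {suc n} g zero    = trans (cong (_+_ (g zero)) (sumℤ-zero {n})) (ℤₚ.+-identityʳ _)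
sumℤ-indicator {suc n} g (suc j) = trans (ℤₚ.+-identityˡ _) (sumℤ-indicator (g ∘ suc) j)

sumℕ-cong : ∀ {n} {f g : Fin n → ℕ} → (∀ i → f i ≡ g i) → sumℕ f ≡ sumℕ g
sumℕ-cong {zero}  f≗g = refl
sumℕ-cong {suc n} f≗g = cong₂ ℕ._+_ (f≗g zero) (sumℕ-cong (f≗g ∘ suc))

sumℕ-*ˡ : ∀ {n} (c : ℕ) (f : Fin n → ℕ) → sumℕ (λ i → c ℕ.* f i) ≡ c ℕ.* sumℕ f
sumℕ-*ˡ {zero}  c f = sym (ℕₚ.*-zeroʳ c)
sumℕ-*ˡ {suc n} c f = trans (cong ((c ℕ.* f zero) ℕ.+_) (sumℕ-*ˡ c (f ∘ suc)))
                            (sym (ℕₚ.*-distribˡ-+ c (f zero) _))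

sumℕ-mono-≤ : ∀ {n} {f g : Fin n → ℕ} → (∀ i → f i ≤ g i) → sumℕ f ≤ sumℕ g
sumℕ-mono-≤ {zero}  f≤g = z≤n
sumℕ-mono-≤ {suc n} f≤g = ℕₚ.+-mono-≤ (f≤g zero) (sumℕ-mono-≤ (f≤g ∘ suc))

+-mono-≤-≡⇒≡ˡ : ∀ {m n o p} → m ≤ o → n ≤ p → m ℕ.+ n ≡ o ℕ.+ p → m ≡ o
+-mono-≤-≡⇒≡ˡ {m} {n} {o} {p} m≤o n≤p eq = ℕₚ.≤-antisym m≤o (ℕₚ.+-cancelʳ-≤ n o m o+n≤m+n)
  where
  o+n≤m+n : o ℕ.+ n ≤ m ℕ.+ n
  o+n≤m+n = subst (o ℕ.+ n ≤_) (sym eq) (ℕₚ.+-monoʳ-≤ o n≤p)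

sumℕ-mono-≤-≡⇒≡ : ∀ {n} {f g : Fin n → ℕ} → (∀ i → f i ≤ g i) → sumℕ f ≡ sumℕ g →
                  ∀ i → f i ≡ g i
sumℕ-mono-≤-≡⇒≡ {suc n} {f} {g} f≤g eq = λ where
    zero    → head≡
    (suc i) → sumℕ-mono-≤-≡⇒≡ (f≤g ∘ suc) tail≡ i
  where
  head≡ : f zero ≡ g zero
  head≡ = +-mono-≤-≡⇒≡ˡ (f≤g zero) (sumℕ-mono-≤ (f≤g ∘ suc)) eq
  tail≡ : sumℕ (f ∘ suc) ≡ sumℕ (g ∘ suc)
  tail≡ = ℕₚ.+-cancelˡ-≡ (g zero) _ _ (subst (λ m → m ℕ.+ _ ≡ _) head≡ eq)

laplacian : ∀ {n} → Graph n → (Fin n → ℕ) → Fin n → ℤ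
laplacian G ν j = sumℤ λ i → + ν i * lookup (Δ G i) j

neighbourSum : ∀ {n} → Graph n → (Fin n → ℕ) → Fin n → ℕ
neighbourSum G ν j = sumℕ λ i → ν i ℕ.* b2ℕ (adj G j i)

pos-*-if : ∀ m (b : Bool) d → + m * (if b then + d else + 0) ≡ (if b then + (m ℕ.* d) else + 0)
pos-*-if m true  d = sym (ℤₚ.pos-* m d)
pos-*-if m false d = ℤₚ.*-zeroʳ (+ m)

laplacian-neighbourSum : ∀ {n} (G : Graph n) (ν : Fin n → ℕ) j →
  laplacian G ν j ≡ + neighbourSum G ν j - + (ν j ℕ.* degree G j)
laplacian-neighbourSum G ν j = begin
  sumℤ (λ i → + ν i * lookup (Δ G i) j)            ≡⟨ sumℤ-cong term ⟩
  sumℤ (λ i → + neighbour i + - diagonal i)        ≡⟨ sumℤ-+ (λ i → + neighbour i) (λ i → - diagonal i) ⟩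
  sumℤ (λ i → + neighbour i) + sumℤ (λ i → - diagonal i)
    ≡⟨ cong₂ _+_ (sumℤ-pos neighbour) (trans (sumℤ-neg diagonal) (cong -_ (sumℤ-indicator _ j))) ⟩
  + neighbourSum G ν j - + (ν j ℕ.* degree G j)    ∎
  where
  neighbour : Fin _ → ℕ
  neighbour i = ν i ℕ.* b2ℕ (adj G j i)
  diagonal : Fin _ → ℤ
  diagonal i = if does (i ≟ j) then + (ν i ℕ.* degree G i) else + 0
  term : ∀ i → + ν i * lookup (Δ G i) j ≡ + neighbour i + - diagonal i
  term i = begin
    + ν i * lookup (Δ G i) j                                    ≡⟨ cong (+ ν i *_) (lookup∘tabulate _ j) ⟩
    + ν i * (+ b2ℕ (adj G j i) - (if does (i ≟ j) then + degree G i else + 0))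
                                                                ≡⟨ ℤₚ.*-distribˡ-+ (+ ν i) _ _ ⟩
    + ν i * + b2ℕ (adj G j i) + + ν i * - (if does (i ≟ j) then + degree G i else + 0)
      ≡⟨ cong₂ _+_ (sym (ℤₚ.pos-* (ν i) _))
                   (trans (sym (ℤₚ.neg-distribʳ-* (+ ν i) _)) (cong -_ (pos-*-if (ν i) _ _))) ⟩
    + neighbour i + - diagonal i                                ∎

laplacian-cong : ∀ {n} (G : Graph n) {f g : Fin n → ℕ} → (∀ i → f i ≡ g i) →
                 ∀ j → laplacian G f j ≡ laplacian G g j
laplacian-cong G f≗g j = sumℤ-cong λ i → cong (λ m → + m * lookup (Δ G i) j) (f≗g i)

laplacian-+ : ∀ {n} (G : Graph n) (f g : Fin n → ℕ) j →
              laplacian G (λ i → f i ℕ.+ g i) j ≡ laplacian G f j + laplacian G g j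
laplacian-+ G f g j = trans (sumℤ-cong distrib)
  (sumℤ-+ (λ i → + f i * lookup (Δ G i) j) (λ i → + g i * lookup (Δ G i) j))
  where
  distrib : ∀ i → + (f i ℕ.+ g i) * lookup (Δ G i) j
                ≡ + f i * lookup (Δ G i) j + + g i * lookup (Δ G i) j
  distrib i = trans (cong (_* lookup (Δ G i) j) (ℤₚ.pos-+ (f i) (g i)))
                    (ℤₚ.*-distribʳ-+ (lookup (Δ G i) j) (+ f i) (+ g i))

Harmonic : ∀ {n} → Graph n → (Fin n → ℕ) → Set
Harmonic G ν = ∀ j → neighbourSum G ν j ≡ ν j ℕ.* degree G j

harmonic⇒laplacian≡0 : ∀ {n} (G : Graph n) ν → Harmonic G ν → ∀ j → laplacian G ν j ≡ + 0
harmonic⇒laplacian≡0 G ν harmonic j =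
  trans (laplacian-neighbourSum G ν j) (ℤₚ.i≡j⇒i-j≡0 (cong +_ (harmonic j)))

laplacian≡0⇒harmonic : ∀ {n} (G : Graph n) ν → (∀ j → laplacian G ν j ≡ + 0) → Harmonic G ν
laplacian≡0⇒harmonic G ν L≡0 j =
  ℤₚ.+-injective (ℤₚ.i-j≡0⇒i≡j _ _ (trans (sym (laplacian-neighbourSum G ν j)) (L≡0 j)))

constant⇒harmonic : ∀ {n} (G : Graph n) (ν : Fin n → ℕ) {c} → (∀ i → ν i ≡ c) → Harmonic G ν
constant⇒harmonic G ν {c} ν≡c j = begin
  neighbourSum G ν j                       ≡⟨ sumℕ-cong (λ i → cong (ℕ._* b2ℕ (adj G j i)) (ν≡c i)) ⟩
  sumℕ (λ i → c ℕ.* b2ℕ (adj G j i))       ≡⟨ sumℕ-*ˡ c (λ i → b2ℕ (adj G j i)) ⟩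
  c ℕ.* degree G j                         ≡⟨ cong (ℕ._* degree G j) (sym (ν≡c j)) ⟩
  ν j ℕ.* degree G j                       ∎

-- Comparing the harmonic identity at k with the same sum for the constant ν k
-- forces ν i · [k ~ i] = ν k · [k ~ i] termwise.
harmonic-max-neighbour : ∀ {n} (G : Graph n) ν {k i} → Harmonic G ν → (∀ l → ν l ≤ ν k) →
                         adj G k i ≡ true → ν i ≡ ν k
harmonic-max-neighbour G ν {k} {i} harmonic ν≤νk k~i =
  trans (sym (ℕₚ.*-identityʳ (ν i))) (trans termwise (ℕₚ.*-identityʳ (ν k)))
  where
  termwise : ν i ℕ.* 1 ≡ ν k ℕ.* 1
  termwise = subst (λ b → ν i ℕ.* b2ℕ b ≡ ν k ℕ.* b2ℕ b) k~i
    (sumℕ-mono-≤-≡⇒≡ (λ l → ℕₚ.*-monoˡ-≤ (b2ℕ (adj G k l)) (ν≤νk l))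
                     (trans (harmonic k) (sym (sumℕ-*ˡ (ν k) (λ l → b2ℕ (adj G k l))))) i)

maximum-principle : ∀ {n} (G : Graph n) ν {k} → Connected G → Harmonic G ν →
                    (∀ l → ν l ≤ ν k) → ∀ i → ν i ≡ ν k
maximum-principle G ν {k} connected harmonic ν≤νk i = along (connected k i) refl
  where
  along : ∀ {j i} → Walk G j i → ν j ≡ ν k → ν i ≡ ν k
  along here         νj≡νk = νj≡νk
  along (step j~ w)  νj≡νk = along w (trans (harmonic-max-neighbour G ν harmonic
    (λ l → subst (ν l ≤_) (sym νj≡νk) (ν≤νk l)) j~) νj≡νk)

lookup-T^ : ∀ {n} (G : Graph n) (v : Vec ℕ n) (α : Vec ℤ n) j →
            lookup (T^ G (map +_ v) α) j ≡ lookup α j + laplacian G (lookup v) j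
lookup-T^ G v α j = trans (lookup∘tabulate _ j) (cong (_+_ (lookup α j))
  (sumℤ-cong λ i → cong (_* lookup (Δ G i) j) (lookup-map i +_ v)))

T^-harmonic : ∀ {n} (G : Graph n) (v : Vec ℕ n) (α : Vec ℤ n) →
              Harmonic G (lookup v) → T^ G (map +_ v) α ≡ α
T^-harmonic G v α harmonic = Pointwise-≡⇒≡ (ext λ j → begin
  lookup (T^ G (map +_ v) α) j           ≡⟨ lookup-T^ G v α j ⟩
  lookup α j + laplacian G (lookup v) j  ≡⟨ cong (_+_ (lookup α j)) (harmonic⇒laplacian≡0 G (lookup v) harmonic j) ⟩
  lookup α j + + 0                       ≡⟨ ℤₚ.+-identityʳ _ ⟩
  lookup α j                             ∎)

T^-fixed⇒harmonic : ∀ {n} (G : Graph n) (v : Vec ℕ n) (α : Vec ℤ n) →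
                    T^ G (map +_ v) α ≡ α → Harmonic G (lookup v)
T^-fixed⇒harmonic G v α fixed = laplacian≡0⇒harmonic G (lookup v) λ j →
  identityʳ-unique (lookup α j) _ (trans (sym (lookup-T^ G v α j)) (cong (λ β → lookup β j) fixed))

T^-∘ : ∀ {n} (G : Graph n) (v w : Vec ℕ n) (α : Vec ℤ n) →
       T^ G (map +_ v) (T^ G (map +_ w) α) ≡ T^ G (map +_ (zipWith ℕ._+_ v w)) α
T^-∘ G v w α = Pointwise-≡⇒≡ (ext λ j → begin
  lookup (T^ G (map +_ v) (T^ G (map +_ w) α)) j
    ≡⟨ lookup-T^ G v (T^ G (map +_ w) α) j ⟩
  lookup (T^ G (map +_ w) α) j + laplacian G (lookup v) j
    ≡⟨ cong (_+ laplacian G (lookup v) j) (lookup-T^ G w α j) ⟩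
  lookup α j + laplacian G (lookup w) j + laplacian G (lookup v) j
    ≡⟨ ℤₚ.+-assoc (lookup α j) _ _ ⟩
  lookup α j + (laplacian G (lookup w) j + laplacian G (lookup v) j)
    ≡⟨ cong (_+_ (lookup α j)) (ℤₚ.+-comm (laplacian G (lookup w) j) _) ⟩
  lookup α j + (laplacian G (lookup v) j + laplacian G (lookup w) j)
    ≡⟨ cong (_+_ (lookup α j)) (sym (trans (laplacian-cong G (λ i → lookup-zipWith ℕ._+_ i v w) j)
                                          (laplacian-+ G (lookup v) (lookup w) j))) ⟩
  lookup α j + laplacian G (lookup (zipWith ℕ._+_ v w)) j
    ≡⟨ sym (lookup-T^ G (zipWith ℕ._+_ v w) α j) ⟩
  lookup (T^ G (map +_ (zipWith ℕ._+_ v w)) α) j ∎)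

nonIncreasing-replicate : ∀ {n} (c : ℕ) → NonIncreasing (replicate n c)
nonIncreasing-replicate c i j _ =
  ℕₚ.≤-reflexive (trans (lookup-replicate j c) (sym (lookup-replicate i c)))

nonIncreasing-+ : ∀ {n} {v w : Vec ℕ n} → NonIncreasing v → NonIncreasing w →
                  NonIncreasing (zipWith ℕ._+_ v w)
nonIncreasing-+ {v = v} {w} v↓ w↓ i j i≤j =
  subst₂ _≤_ (sym (lookup-zipWith ℕ._+_ j v w)) (sym (lookup-zipWith ℕ._+_ i v w))
         (ℕₚ.+-mono-≤ (v↓ i j i≤j) (w↓ i j i≤j))

≼-refl : ∀ {n} (G : Graph n) {α : Vec ℤ n} → G ⊢ α ≼ α
≼-refl {n} G {α} = replicate n 0 , nonIncreasing-replicate 0 , sym (T^-harmonic G (replicate n 0) α zero-harmonic)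
  where
  zero-harmonic : Harmonic G (lookup (replicate n 0))
  zero-harmonic = constant⇒harmonic G (lookup (replicate n 0)) (λ i → lookup-replicate i 0)

≼-trans : ∀ {n} (G : Graph n) {α β γ : Vec ℤ n} → G ⊢ α ≼ β → G ⊢ β ≼ γ → G ⊢ α ≼ γ
≼-trans G {γ = γ} (v , v↓ , α≡) (w , w↓ , β≡) =
  zipWith ℕ._+_ v w , nonIncreasing-+ {v = v} {w} v↓ w↓ ,
  trans α≡ (trans (cong (T^ G (map +_ v)) β≡) (T^-∘ G v w γ))

-- Being nonincreasing, ν attains its maximum at the first vertex.
fixed-nonIncreasing⇒constant : ∀ {n} (G : Graph (suc n)) → Connected G →
  ∀ {ν α} → NonIncreasing ν → T^ G (map +_ ν) α ≡ α → ∀ i → lookup ν i ≡ lookup ν zero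
fixed-nonIncreasing⇒constant G connected {ν} {α} ν↓ fixed =
  maximum-principle G (lookup ν) connected (T^-fixed⇒harmonic G ν α fixed) (λ l → ν↓ zero l z≤n)

≼-antisym : ∀ {n} (G : Graph n) → Connected G → ∀ {α β : Vec ℤ n} →
            G ⊢ α ≼ β → G ⊢ β ≼ α → α ≡ β
≼-antisym {zero}  G connected {[]} {[]} _ _ = refl
≼-antisym {suc n} G connected {α} {β} α≼β@(v , v↓ , α≡) β≼α@(w , w↓ , _) =
  trans α≡ (T^-harmonic G v β (constant⇒harmonic G (lookup v) v-constant))
  where
  v+w-constant : ∀ i → lookup (zipWith ℕ._+_ v w) i ≡ lookup (zipWith ℕ._+_ v w) zero
  v+w-constant = let (_ , v+w↓ , α≡α) = ≼-trans G {γ = α} α≼β β≼α in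
    fixed-nonIncreasing⇒constant G connected {zipWith ℕ._+_ v w} v+w↓ (sym α≡α)
  v-constant : ∀ i → lookup v i ≡ lookup v zero
  v-constant i = +-mono-≤-≡⇒≡ˡ (v↓ zero i z≤n) (w↓ zero i z≤n)
    (subst₂ _≡_ (lookup-zipWith ℕ._+_ i v w) (lookup-zipWith ℕ._+_ zero v w) (v+w-constant i))

mainTheorem5 : ∀ {n : ℕ} (G : Graph n) → Connected G →
    IsPartialOrder {A = Vec ℤ n} _≡_ (G ⊢_≼_)
mainTheorem5 G connected = record
  { isPreorder = record
    { isEquivalence = isEquivalence
    ; reflexive     = λ { refl → ≼-refl G }
    ; trans         = λ {_} {_} {γ} → ≼-trans G {γ = γ}
    }
  ; antisym = ≼-antisym G connected
  }
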